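{- For any finite connected graph $G$, $c_H(G) \leq c(G) + \Upsilon(G)$.
   Context: Hyperopic Cops and Robber on a graph $G$ (each vertex considered to carry a loop, so a player may stay put): the cops first occupy a multiset of vertices, then the robber chooses a vertex. In each round, each cop moves to an adjacent vertex or stays, then the robber moves to an adjacent vertex or stays. The robber always sees all cops. The cops see the robber's position except when the robber's vertex is adjacent to every vertex occupied by a cop, in which case the robber is invisible. The robber is captured when a cop occupies the robber's vertex. $c_H(G)$ (the hyperopic cop number) is the minimum number of cops that can guarantee capture in finitely many moves; $c(G)$ is the classical cop number (same game with the robber always visible). $N(v)$ denotes the open neighbourhood of $v$. A non-empty set $S \subseteq V(G)$ is a small common neighbourhood set if $\left|\bigcap_{v\in S} N(v)\right| \le |S|$; $\Upsilon(G)$ is the minimum cardinality of such a set. -}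

module Defs where

open import Data.Nat using (ℕ; zero; suc; _≤_; _+_)
open import Data.Bool using (Bool; true; false; T; _∧_; _∨_; not; if_then_else_)
open import Data.Fin using (Fin)
open import Data.Fin.Subset using (Subset; Nonempty; ∣_∣)
open import Data.Vec using (lookup; tabulate)
open import Data.Maybe using (Maybe; just; nothing)
open import Data.List using (List; []; _∷_)
open import Data.Product using (Σ; ∃; _×_; _,_; proj₁; proj₂)
open import Data.Sum using (_⊎_)
open import Relation.Binary.PropositionalEquality using (_≡_)
open import Relation.Nullary using (¬_)

-- Loops are NOT part of adj; the "each
-- vertex carries a loop" convention is modelled by allowing a player
-- to stay put (see Step).

record Graph : Set where
  field
    n     : ℕ
    adj   : Fin n → Fin n → Bool
    sym   : ∀ u v → adj u v ≡ adj v u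
    irrefl : ∀ v → adj v v ≡ false

module _ (G : Graph) where
  open Graph G

  V : Set
  V = Fin n

  Adj : V → V → Set
  Adj u v = T (adj u v)

  Step : V → V → Set
  Step u v = u ≡ v ⊎ Adj u v

  data Walk : V → V → Set where
    here  : ∀ {v} → Walk v v
    there : ∀ {u w v} → Adj u w → Walk w v → Walk u v

  Connected : Set
  Connected = ∀ u v → Walk u v

allFin : ∀ {m} → (Fin m → Bool) → Bool
allFin {zero}  f = true
allFin {suc m} f = f Fin.zero ∧ allFin (λ i → f (Fin.suc i))

-- A visibility rule tells, for a cop configuration and the robber's
-- vertex, what the cops observe: just r (robber seen at r) or nothing
-- (robber invisible).

module Game (G : Graph) where
  open Graph G

  Config : ℕ → Set
  Config k = Fin k → V G

  Visibility : ℕ → Set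
  Visibility k = Config k → V G → Maybe (V G)

  fullVis : ∀ {k} → Visibility k
  fullVis c r = just r

  hyperVis : ∀ {k} → Visibility k
  hyperVis c r = if allFin (λ i → adj (c i) r) then nothing else just r

  -- Observation history (most recent first).
  History : Set
  History = List (Maybe (V G))

  record Strategy (k : ℕ) : Set where
    field
      start : Config k
      move  : History → (c : Config k) →
              Σ (Config k) (λ c' → ∀ i → Step G (c i) (c' i))

  RobberPlay : Set
  RobberPlay = Σ (ℕ → V G) (λ r → ∀ t → Step G (r t) (r (suc t)))

  -- play σ r t = (C_t , history available to the cops after the robber's
  -- t-th placement/move).  Round t+1: cops move C_t ↦ C_{t+1} (and observe
  -- R_t against C_{t+1}), then robber moves R_t ↦ R_{t+1} (observed
  -- against C_{t+1}).
  play : ∀ {k} → Visibility k → Strategy k → (ℕ → V G) → ℕ → Config k × History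
  play vis σ r zero = Strategy.start σ , (vis (Strategy.start σ) (r zero) ∷ [])
  play vis σ r (suc t) with play vis σ r t
  ... | c , h =
    let c' = proj₁ (Strategy.move σ h c)
    in c' , (vis c' (r (suc t)) ∷ vis c' (r t) ∷ h)

  cops : ∀ {k} → Visibility k → Strategy k → (ℕ → V G) → ℕ → Config k
  cops vis σ r t = proj₁ (play vis σ r t)

  -- the robber is captured at time t: either a cop occupies R_t in
  -- configuration C_t (after the robber's move / initial placement) or
  -- in configuration C_{t+1} (after the cops' move of the next round)
  CapturedAt : ∀ {k} → Visibility k → Strategy k → (ℕ → V G) → ℕ → Set
  CapturedAt vis σ r t =
    ∃ (λ i → cops vis σ r t i ≡ r t) ⊎ ∃ (λ i → cops vis σ r (suc t) i ≡ r t)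

  CopsWin : (k : ℕ) → Visibility k → Set
  CopsWin k vis = Σ (Strategy k) (λ σ →
    (ρ : RobberPlay) → ∃ (λ t → CapturedAt vis σ (proj₁ ρ) t))

  ClassicalWin : ℕ → Set
  ClassicalWin k = CopsWin k fullVis

  HyperopicWin : ℕ → Set
  HyperopicWin k = CopsWin k hyperVis

IsCopNumber : Graph → ℕ → Set
IsCopNumber G k = Game.ClassicalWin G k × (∀ j → Game.ClassicalWin G j → k ≤ j)

IsHyperopicCopNumber : Graph → ℕ → Set
IsHyperopicCopNumber G k =
  Game.HyperopicWin G k × (∀ j → Game.HyperopicWin G j → k ≤ j)

commonNbhd : (G : Graph) → Subset (Graph.n G) → Subset (Graph.n G)
commonNbhd G S =
  tabulate (λ u → allFin (λ v → not (lookup S v) ∨ Graph.adj G v u))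

SmallCNS : (G : Graph) → Subset (Graph.n G) → Set
SmallCNS G S = Nonempty S × ∣ commonNbhd G S ∣ ≤ ∣ S ∣

IsUpsilon : Graph → ℕ → Set
IsUpsilon G m =
  Σ (Subset (Graph.n G)) (λ S → SmallCNS G S × ∣ S ∣ ≡ m) ×
  (∀ S → SmallCNS G S → m ≤ ∣ S ∣)

-- Add to a winning classical team of c cops a squad of Υ(G) guards, posted on
-- the vertices of a small common neighbourhood set S.  The robber can only be
-- invisible while adjacent to every cop, in particular to every vertex of S;
-- it then stands in ⋂_{v∈S} N(v), a set of at most |S| vertices, and sending
-- the guards to those vertices captures it at once.  While the robber is
-- visible the guards stay on S and the classical cops follow their winning
-- strategy, so the robber is caught either way.
module Submission where

open import Defs
open import Data.Nat using (ℕ; zero; suc; _≤_; _+_; s≤s)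
open import Data.Nat.Properties using (≤-trans; ≤-reflexive)
open import Data.Bool using (Bool; true; false; T; _∨_; not; if_then_else_)
open import Data.Bool.Properties using (if-eta)
open import Data.Unit using (tt)
open import Data.Fin using (Fin; _↑ˡ_; _↑ʳ_)
open import Data.Fin.Subset using (Subset; ∣_∣)
open import Data.Vec using (lookup; []; _∷_)
open import Data.Vec.Properties using (lookup∘tabulate)
open import Data.Vec.Functional using (_++_)
open import Data.Vec.Functional.Properties using (lookup-++ˡ; lookup-++ʳ)
open import Data.Maybe using (just; nothing)
open import Data.List using ([]; _∷_)
open import Data.Product using (Σ; ∃; _,_; proj₁; proj₂)
open import Data.Sum using (_⊎_; inj₁; inj₂)
open import Function using (_∘_; id)
open import Relation.Binary.PropositionalEquality

allFin⁻ : ∀ {m} (f : Fin m → Bool) → allFin f ≡ true → ∀ i → f i ≡ true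
allFin⁻ {suc m} f eq i with f Fin.zero in f₀
allFin⁻ {suc m} f eq Fin.zero    | true = f₀
allFin⁻ {suc m} f eq (Fin.suc i) | true = allFin⁻ (f ∘ Fin.suc) eq i

allFin⁺ : ∀ {m} (f : Fin m → Bool) → (∀ i → f i ≡ true) → allFin f ≡ true
allFin⁺ {zero}  f all = refl
allFin⁺ {suc m} f all rewrite all Fin.zero = allFin⁺ (f ∘ Fin.suc) (all ∘ Fin.suc)

_Covers_ : ∀ {m n} → (Fin m → Fin n) → Subset n → Set
f Covers p = ∀ u → lookup p u ≡ true → ∃ λ j → f j ≡ u

-- The map ι is only there to make the induction on p go through.
enumerate : ∀ {n N} (ι : Fin n → Fin N) (d : Fin N) (p : Subset n) (m : ℕ) →
  ∣ p ∣ ≤ m →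
  Σ (Fin m → Fin N) λ f → ∀ u → lookup p u ≡ true → ∃ λ j → f j ≡ ι u
enumerate ι d []          m _     = (λ _ → d) , λ ()
enumerate ι d (false ∷ p) m |p|≤m with enumerate (ι ∘ Fin.suc) d p m |p|≤m
... | f , covers = f , λ { Fin.zero () ; (Fin.suc u) → covers u }
enumerate {N = N} ι d (true ∷ p) (suc m) (s≤s |p|≤m) with enumerate (ι ∘ Fin.suc) d p m |p|≤m
... | f , covers = f′ , covers′
  where
  f′ : Fin (suc m) → Fin N
  f′ Fin.zero    = ι Fin.zero
  f′ (Fin.suc j) = f j
  covers′ : ∀ u → lookup (true ∷ p) u ≡ true → ∃ λ j → f′ j ≡ ι u
  covers′ Fin.zero    _  = Fin.zero , refl
  covers′ (Fin.suc u) u∈p with covers u u∈p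
  ... | j , fj≡u = Fin.suc j , fj≡u

module _ (G : Graph) where
  open Graph G using (adj)

  stepTowards : V G → V G → V G
  stepTowards p t = if adj p t then t else p

  stepTowards-legal : ∀ p t → Step G p (stepTowards p t)
  stepTowards-legal p t with adj p t in p~t
  ... | true  = inj₂ (subst T (sym p~t) tt)
  ... | false = inj₁ refl

  stepTowards-reaches : ∀ {p t} → Step G p t → stepTowards p t ≡ t
  stepTowards-reaches {p} (inj₁ refl) = if-eta (adj p p)
  stepTowards-reaches {p} {t} (inj₂ p~t) with adj p t
  ... | true = refl

  hyperVis-unseen : ∀ {k} (c : Game.Config G k) r →
    Game.hyperVis G c r ≡ nothing → ∀ i → adj (c i) r ≡ true
  hyperVis-unseen c r unseen with allFin (λ i → adj (c i) r) in all
  ... | true = allFin⁻ _ all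

  hyperVis-seen-or-unseen : ∀ {k} (c : Game.Config G k) r →
    Game.hyperVis G c r ≡ just r ⊎ Game.hyperVis G c r ≡ nothing
  hyperVis-seen-or-unseen c r with allFin (λ i → adj (c i) r)
  ... | true  = inj₂ refl
  ... | false = inj₁ refl

record Guard (G : Graph) (m : ℕ) : Set where
  field
    post    : Fin m → V G
    target  : Fin m → V G
    catches : ∀ r → (∀ j → Graph.adj G (post j) r ≡ true) → ∃ λ j → target j ≡ r

smallCNS⇒guard : ∀ {G S m} → SmallCNS G S → ∣ S ∣ ≤ m → Guard G m
smallCNS⇒guard {G} {S} {m} ((s , _) , small) |S|≤m = record
  { post    = proj₁ members
  ; target  = proj₁ commonNeighbours
  ; catches = λ r adjacent →
      proj₂ commonNeighbours r
        (trans (lookup∘tabulate _ r) (allFin⁺ _ (adjacentToS r adjacent)))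
  }
  where
  open Graph G using (adj)
  members : Σ (Fin m → V G) (_Covers S)
  members = enumerate id s S m |S|≤m
  commonNeighbours : Σ (Fin m → V G) (_Covers commonNbhd G S)
  commonNeighbours = enumerate id s (commonNbhd G S) m (≤-trans small |S|≤m)

  adjacentToS : ∀ r → (∀ j → adj (proj₁ members j) r ≡ true) →
                ∀ v → (not (lookup S v) ∨ adj v r) ≡ true
  adjacentToS r adjacent v with lookup S v in v∈S
  ... | false = refl
  ... | true with proj₂ members v v∈S
  ...   | j , refl = adjacent j

module HyperopicFromClassical (G : Graph) {k m : ℕ}
  (σ : Game.Strategy G k) (guard : Guard G m) where
  open Game G
  open Guard guard
  module σ = Strategy σ

  -- The second entry of each hyperopic round, the robber's previous vertex
  -- seen against the new cops, is replaced by the first entry of the previous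
  -- round, which recorded that same vertex.
  classicalHistory : History → History
  classicalHistory []               = []
  classicalHistory (a ∷ [])         = a ∷ []
  classicalHistory (a ∷ _ ∷ [])     = a ∷ []
  classicalHistory (a ∷ _ ∷ b ∷ h)  = a ∷ b ∷ classicalHistory (b ∷ h)

  positionsAfter : History → Config k
  positionsAfter []          = σ.start
  positionsAfter (_ ∷ [])    = σ.start
  positionsAfter (_ ∷ _ ∷ h) = proj₁ (σ.move h (positionsAfter h))

  chase : History → Config k
  chase h = proj₁ (σ.move (classicalHistory h) (positionsAfter (classicalHistory h)))

  aim : History → Config (k + m) → Config (k + m)
  aim []             c = c
  aim h@(just _ ∷ _) c = chase h ++ (c ∘ (k ↑ʳ_))
  aim (nothing ∷ _)  c = (c ∘ (_↑ˡ m)) ++ target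

  strategy : Strategy (k + m)
  Strategy.start strategy  = σ.start ++ post
  Strategy.move  strategy h c =
    (λ x → stepTowards G (c x) (aim h c x)) , λ x → stepTowards-legal G (c x) (aim h c x)

  module Against (r : ℕ → V G) where
    C : ℕ → Config (k + m)
    C = cops hyperVis strategy r

    D : ℕ → Config k
    D = cops fullVis σ r

    H F : ℕ → History
    H t = proj₂ (play hyperVis strategy r t)
    F t = proj₂ (play fullVis σ r t)

    earlier : ℕ → History
    earlier zero    = []
    earlier (suc t) = hyperVis (C (suc t)) (r t) ∷ H t

    H-shape : ∀ t → H t ≡ hyperVis (C t) (r t) ∷ earlier t
    H-shape zero    = refl
    H-shape (suc t) = refl

    D≡positionsAfter : ∀ t → D t ≡ positionsAfter (F t)
    D≡positionsAfter zero    = refl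
    D≡positionsAfter (suc t) = cong (proj₁ ∘ σ.move (F t)) (D≡positionsAfter t)

    record Simulates (t : ℕ) : Set where
      field
        cops≡    : ∀ i → C t (i ↑ˡ m) ≡ D t i
        guards≡  : ∀ j → C t (k ↑ʳ j) ≡ post j
        history≡ : hyperVis (C t) (r t) ≡ just (r t) → classicalHistory (H t) ≡ F t
    open Simulates

    simulates-start : Simulates zero
    simulates-start = record
      { cops≡    = lookup-++ˡ σ.start post
      ; guards≡  = lookup-++ʳ σ.start post
      ; history≡ = cong (_∷ [])
      }

    unseen⇒captured : ∀ {t} → Simulates t → hyperVis (C t) (r t) ≡ nothing →
      CapturedAt hyperVis strategy r t
    unseen⇒captured {t} sim unseen = inj₂ (k ↑ʳ j , captures)
      where
      open ≡-Reasoning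
      adjacent : ∀ j → Graph.adj G (post j) (r t) ≡ true
      adjacent j = subst (λ v → Graph.adj G v (r t) ≡ true) (guards≡ sim j)
                     (hyperVis-unseen G (C t) (r t) unseen (k ↑ʳ j))
      j : Fin m
      j = proj₁ (catches (r t) adjacent)
      captures : C (suc t) (k ↑ʳ j) ≡ r t
      captures = begin
        stepTowards G (C t (k ↑ʳ j)) (aim (H t) (C t) (k ↑ʳ j))
          ≡⟨ cong (λ h → stepTowards G (C t (k ↑ʳ j)) (aim h (C t) (k ↑ʳ j)))
                  (trans (H-shape t) (cong (_∷ earlier t) unseen)) ⟩
        stepTowards G (C t (k ↑ʳ j)) (((C t ∘ (_↑ˡ m)) ++ target) (k ↑ʳ j))
          ≡⟨ cong₂ (stepTowards G) (guards≡ sim j)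
                   (trans (lookup-++ʳ (C t ∘ (_↑ˡ m)) target j)
                          (proj₂ (catches (r t) adjacent))) ⟩
        stepTowards G (post j) (r t)
          ≡⟨ stepTowards-reaches G (inj₂ (subst T (sym (adjacent j)) tt)) ⟩
        r t ∎

    seen⇒simulates : ∀ {t} → Simulates t → hyperVis (C t) (r t) ≡ just (r t) →
      Simulates (suc t)
    seen⇒simulates {t} sim seen = record
      { cops≡    = cops≡′
      ; guards≡  = guards≡′
      ; history≡ = λ seen′ → trans (history≡′ _ _) (cong (_∷ just (r t) ∷ F t) seen′)
      }
      where
      open ≡-Reasoning
      H≡ : H t ≡ just (r t) ∷ earlier t
      H≡ = trans (H-shape t) (cong (_∷ earlier t) seen)

      history≡H : classicalHistory (just (r t) ∷ earlier t) ≡ F t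
      history≡H = subst (λ h → classicalHistory h ≡ F t) H≡ (history≡ sim seen)

      history≡′ : ∀ a b → classicalHistory (a ∷ b ∷ H t) ≡ a ∷ just (r t) ∷ F t
      history≡′ a b rewrite H≡ = cong (λ h → a ∷ just (r t) ∷ h) history≡H

      chase≡ : chase (H t) ≡ proj₁ (σ.move (F t) (D t))
      chase≡ = begin
        chase (H t)
          ≡⟨ cong (λ h → proj₁ (σ.move h (positionsAfter h))) (history≡ sim seen) ⟩
        proj₁ (σ.move (F t) (positionsAfter (F t)))
          ≡⟨ cong (proj₁ ∘ σ.move (F t)) (sym (D≡positionsAfter t)) ⟩
        proj₁ (σ.move (F t) (D t)) ∎

      aim≡ : aim (H t) (C t) ≡ chase (H t) ++ (C t ∘ (k ↑ʳ_))
      aim≡ rewrite H≡ = refl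

      cops≡′ : ∀ i → C (suc t) (i ↑ˡ m) ≡ D (suc t) i
      cops≡′ i = begin
        stepTowards G (C t (i ↑ˡ m)) (aim (H t) (C t) (i ↑ˡ m))
          ≡⟨ cong (λ c → stepTowards G (C t (i ↑ˡ m)) (c (i ↑ˡ m))) aim≡ ⟩
        stepTowards G (C t (i ↑ˡ m)) ((chase (H t) ++ (C t ∘ (k ↑ʳ_))) (i ↑ˡ m))
          ≡⟨ cong₂ (stepTowards G) (cops≡ sim i)
                   (trans (lookup-++ˡ (chase (H t)) _ i) (cong (λ c → c i) chase≡)) ⟩
        stepTowards G (D t i) (proj₁ (σ.move (F t) (D t)) i)
          ≡⟨ stepTowards-reaches G (proj₂ (σ.move (F t) (D t)) i) ⟩
        D (suc t) i ∎

      guards≡′ : ∀ j → C (suc t) (k ↑ʳ j) ≡ post j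
      guards≡′ j = begin
        stepTowards G (C t (k ↑ʳ j)) (aim (H t) (C t) (k ↑ʳ j))
          ≡⟨ cong (λ c → stepTowards G (C t (k ↑ʳ j)) (c (k ↑ʳ j))) aim≡ ⟩
        stepTowards G (C t (k ↑ʳ j)) ((chase (H t) ++ (C t ∘ (k ↑ʳ_))) (k ↑ʳ j))
          ≡⟨ cong (stepTowards G (C t (k ↑ʳ j))) (lookup-++ʳ (chase (H t)) _ j) ⟩
        stepTowards G (C t (k ↑ʳ j)) (C t (k ↑ʳ j))
          ≡⟨ stepTowards-reaches G (inj₁ refl) ⟩
        C t (k ↑ʳ j)
          ≡⟨ guards≡ sim j ⟩
        post j ∎

    captured-or-simulates : ∀ t →
      (∃ λ s → CapturedAt hyperVis strategy r s) ⊎ Simulates t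
    captured-or-simulates zero = inj₂ simulates-start
    captured-or-simulates (suc t) with captured-or-simulates t
    ... | inj₁ captured = inj₁ captured
    ... | inj₂ sim with hyperVis-seen-or-unseen G (C t) (r t)
    ...   | inj₁ seen   = inj₂ (seen⇒simulates sim seen)
    ...   | inj₂ unseen = inj₁ (t , unseen⇒captured sim unseen)

    capturedᶜ⇒capturedᴴ : (∃ λ t → CapturedAt fullVis σ r t) →
                          ∃ λ t → CapturedAt hyperVis strategy r t
    capturedᶜ⇒capturedᴴ (t , captured)
      with captured-or-simulates t | captured-or-simulates (suc t)
    ... | inj₁ earlier-capture | _ = earlier-capture
    ... | inj₂ _ | inj₁ earlier-capture = earlier-capture
    ... | inj₂ sim | inj₂ sim′ with captured
    ...   | inj₁ (i , caught) = t , inj₁ (i ↑ˡ m , trans (cops≡ sim i) caught)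
    ...   | inj₂ (i , caught) = t , inj₂ (i ↑ˡ m , trans (cops≡ sim′ i) caught)

  wins : ((ρ : RobberPlay) → ∃ λ t → CapturedAt fullVis σ (proj₁ ρ) t) →
         HyperopicWin (k + m)
  wins σ-wins = strategy , λ ρ → Against.capturedᶜ⇒capturedᴴ (proj₁ ρ) (σ-wins ρ)

classical+guard⇒hyperopic : ∀ {G k m} →
  Game.ClassicalWin G k → Guard G m → Game.HyperopicWin G (k + m)
classical+guard⇒hyperopic {G} (σ , σ-wins) guard =
  HyperopicFromClassical.wins G σ guard σ-wins

theorem3p3 : (G : Graph) → Connected G → (c cH υ : ℕ) →
    IsCopNumber G c → IsHyperopicCopNumber G cH → IsUpsilon G υ →
    cH ≤ c + υ
theorem3p3 G _ c cH υ (c-wins , _) (_ , cH-minimal) ((S , cns , |S|≡υ) , _) =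
  cH-minimal (c + υ) (classical+guard⇒hyperopic c-wins (smallCNS⇒guard cns (≤-reflexive |S|≡υ)))
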